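{- Let $\mathcal H=(V,E)$ be a hypergraph, $k$ a positive integer and $L$ a $k$-assignment of $\mathcal H$. Then for any non-empty subset $A\subseteq E$, $$\beta(A,L)-k^{c(A)}\le -\frac{k^{c(A)-1}}{|A|}\sum_{e\in A}\alpha(e,L).$$
   Context: Hypergraphs are finite; every edge has at least $2$ vertices and no edge is contained in another. A $k$-assignment $L$ of $\mathcal H$ assigns to each vertex $v$ a set $L(v)\subseteq\mathbb N$ with $|L(v)|=k$. For $A\subseteq E$, $\mathcal H\langle A\rangle$ is the spanning subhypergraph with vertex set $V$ and edge set $A$, and $c(A)$ is its number of connected components. If $\mathcal H_1,\dots,\mathcal H_{c(A)}$ are the components of $\mathcal H\langle A\rangle$ (isolated vertices included), then $\beta(A,L)=\prod_{i=1}^{c(A)}\left|\bigcap_{v\in V(\mathcal H_i)}L(v)\right|$. For an edge $e$, $\alpha(e,L)=k-\left|\bigcap_{v\in e}L(v)\right|$. -}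

module Defs where

open import Data.Nat as ℕ using (ℕ; zero; suc; _≤_; _<_; z≤n; s≤s)
open import Data.Nat.Properties using (≤-trans)
open import Data.Fin using (Fin)
open import Data.Fin.Properties using (all?)
open import Data.Fin.Subset using (Subset; _∈_; _⊆_; ∣_∣; Nonempty; inside; outside)
import Data.Fin.Subset.Properties as SP
open import Data.List using (List; length; filter; upTo; allFin; map; foldr)
open import Data.Nat.ListAction using (sum; product)
open import Data.List.Membership.DecPropositional ℕ._≟_ using () renaming (_∈_ to _∈ℓ_; _∈?_ to _∈ℓ?_)
open import Data.List.Relation.Unary.Unique.Propositional using (Unique)
open import Data.Vec using (tabulate)
open import Data.Product using (Σ; ∃; _×_; _,_; proj₁; proj₂)
open import Relation.Nullary using (¬_; does; _→-dec_)
open import Relation.Binary.PropositionalEquality using (_≡_; _≢_)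
open import Data.Integer as ℤ using (ℤ; +_)
open import Data.Rational using (ℚ; _/_)
import Data.Fin as F

-- Every edge has at least 2 vertices; no edge is contained in another
-- (in particular distinct indices give distinct edges, so E is a set of m edges).
record Hypergraph (n m : ℕ) : Set where
  field
    edge      : Fin m → Subset n
    edge-size : ∀ j → 2 ≤ ∣ edge j ∣
    antichain : ∀ i j → i ≢ j → ¬ (edge i ⊆ edge j)
open Hypergraph public

data Conn {n m : ℕ} (H : Hypergraph n m) (A : Subset m) (u : Fin n) : Fin n → Set where
  here : Conn H A u u
  step : ∀ {w x} (j : Fin m) → Conn H A u w → j ∈ A → w ∈ edge H j → x ∈ edge H j → Conn H A u x

-- Then c = c(A) (isolated vertices are components).
record IsComponentLabelling {n m : ℕ} (H : Hypergraph n m) (A : Subset m)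
         (c : ℕ) (comp : Fin n → Fin c) : Set where
  field
    surjective : ∀ (i : Fin c) → ∃ λ v → comp v ≡ i
    sound      : ∀ u w → comp u ≡ comp w → Conn H A u w
    complete   : ∀ u w → Conn H A u w → comp u ≡ comp w

KAssignment : {n : ℕ} → ℕ → (Fin n → List ℕ) → Set
KAssignment k L = ∀ v → length (L v) ≡ k × Unique (L v)

bound : {n : ℕ} → (Fin n → List ℕ) → ℕ
bound {n} L = suc (sum (map (λ v → sum (L v)) (allFin n)))

-- | ⋂_{v ∈ S} L(v) | for nonempty S: the number of x ∈ ℕ lying in every L(v), v ∈ S.
-- (All such x are < bound L, so it suffices to count x < bound L.)
interCard : {n : ℕ} → (Fin n → List ℕ) → Subset n → ℕ
interCard L S =
  length (filter (λ x → all? (λ v → SP._∈?_ v S →-dec x ∈ℓ? L v)) (upTo (bound L)))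

classOf : {n c : ℕ} → (Fin n → Fin c) → Fin c → Subset n
classOf comp i = tabulate (λ v → does (comp v F.≟ i))

β : {n c : ℕ} → (Fin n → List ℕ) → (Fin n → Fin c) → ℕ
β {c = c} L comp = product (map (λ i → interCard L (classOf comp i)) (allFin c))

α : {n m : ℕ} → Hypergraph n m → ℕ → (Fin n → List ℕ) → Fin m → ℤ
α H k L j = + k ℤ.- + interCard L (edge H j)

sumα : {n m : ℕ} → Hypergraph n m → ℕ → (Fin n → List ℕ) → Subset m → ℤ
sumα {m = m} H k L A =
  foldr ℤ._+_ (+ 0) (map (α H k L) (filter (λ j → SP._∈?_ j A) (allFin m)))

∣A∣>0 : {m : ℕ} (A : Subset m) → Nonempty A → 0 < ∣ A ∣
∣A∣>0 A (x , x∈A) = ≤-trans (s≤s z≤n) (SP.x∈p⇒∣p-x∣<∣p∣ x∈A)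

divByCard : {m : ℕ} → ℤ → (A : Subset m) → Nonempty A → ℚ
divByCard z A ne = _/_ z ∣ A ∣ {{ℕ.>-nonZero (∣A∣>0 A ne)}}

-- For an edge e of A with a vertex v, the component of v contains e, so its colour
-- intersection lies inside ⋂_{v∈e} L(v); bounding the other c(A) − 1 factors of β(A,L)
-- by k gives β(A,L) ≤ (k − α(e,L)) k^{c(A)−1}, i.e. k^{c(A)−1} α(e,L) ≤ k^{c(A)} − β(A,L).
-- Averaging this over the edges of A is the claim.
module Submission where

open import Defs
open import Data.Nat as ℕ using (ℕ; suc; _≤_; _*_; _^_; _∸_; z≤n; s≤s; NonZero)
import Data.Nat.Properties as ℕ
open import Data.Nat.ListAction using (product)
open import Data.Nat.ListAction.Properties using (product-↭)
open import Data.Integer as ℤ using (ℤ; +_; +≤+) renaming (_≤_ to _≤ℤ_)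
import Data.Integer.Properties as ℤ
open import Data.Integer.Tactic.RingSolver using (solve-∀)
open import Data.Rational as ℚ using (_/_; toℚᵘ)
import Data.Rational.Properties as ℚ
open import Data.Rational.Unnormalised as ℚᵘ using (mkℚᵘ; *≤*)
import Data.Rational.Unnormalised.Properties as ℚᵘ
open import Data.Fin as Fin using (Fin)
open import Data.Fin.Properties using (all?; nonZeroIndex)
open import Data.Fin.Subset using (Subset; Nonempty; ∣_∣; inside; outside)
  renaming (_∈_ to _∈ₛ_; _⊆_ to _⊆ₛ_)
import Data.Fin.Subset.Properties as Subset
import Data.Vec as Vec
open import Data.Vec using ([]; _∷_)
open import Data.Vec.Properties using (lookup∘tabulate; lookup⇒[]=)
open import Data.List using (List; []; _∷_; _++_; length; filter; map; foldr; tabulate; upTo; allFin)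
open import Data.List.Properties using (length-map; length-tabulate)
open import Data.List.Membership.Propositional using (_∈_)
open import Data.List.Membership.Propositional.Properties using (∈-∃++; ∈-filter⁻; ∈-map⁺; ∈-allFin)
open import Data.List.Membership.DecPropositional ℕ._≟_ using (_∈?_)
open import Data.List.Relation.Binary.Subset.Propositional using (_⊆_)
open import Data.List.Relation.Binary.Permutation.Propositional.Properties
  using (shift; ↭-length; ∈-resp-↭; All-resp-↭)
open import Data.List.Relation.Binary.Sublist.Propositional using (⊆-refl)
import Data.List.Relation.Binary.Sublist.Propositional.Properties as Sublist
open import Data.List.Relation.Unary.All as All using (All; []; _∷_)
import Data.List.Relation.Unary.All.Properties as All
open import Data.List.Relation.Unary.Any using (here; there)
open import Data.List.Relation.Unary.AllPairs using (_∷_)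
open import Data.List.Relation.Unary.Unique.Propositional using (Unique)
import Data.List.Relation.Unary.Unique.Propositional.Properties as Unique
open import Data.Product using (_,_; proj₁; proj₂)
open import Data.Empty using (⊥-elim)
open import Function using (_∘_)
open import Relation.Nullary using (Dec; yes; no; contradiction; _→-dec_)
open import Relation.Nullary.Decidable using (dec-true)
open import Relation.Unary using (Decidable)
open import Relation.Binary.PropositionalEquality

private
  variable
    A : Set
    n m c k : ℕ

unique-⊆⇒length-≤ : {xs ys : List A} → Unique xs → xs ⊆ ys → length xs ≤ length ys
unique-⊆⇒length-≤ {xs = []} _ _ = z≤n
unique-⊆⇒length-≤ {xs = x ∷ xs} (x∉xs ∷ unique-xs) xs⊆ys
  with ws , zs , refl ← ∈-∃++ (xs⊆ys (here refl)) =
  ℕ.≤-trans (s≤s (unique-⊆⇒length-≤ unique-xs xs⊆ws++zs))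
            (ℕ.≤-reflexive (sym (↭-length (shift x ws zs))))
  where
  xs⊆ws++zs : xs ⊆ ws ++ zs
  xs⊆ws++zs {z} z∈xs with ∈-resp-↭ (shift x ws zs) (xs⊆ys (there z∈xs))
  ... | here refl = ⊥-elim (All.lookup x∉xs z∈xs refl)
  ... | there z∈ws++zs = z∈ws++zs

length-filter-mono : ∀ {P Q : A → Set} (P? : Decidable P) (Q? : Decidable Q) →
  (∀ {x} → P x → Q x) → ∀ xs → length (filter P? xs) ≤ length (filter Q? xs)
length-filter-mono P? Q? P⇒Q xs =
  Sublist.length-mono-≤ (Sublist.filter⁺ P? Q? (λ { refl → P⇒Q }) (⊆-refl {x = xs}))

length-filter-tabulate : ∀ {P : A → Set} (P? : Decidable P) (f : Fin m → A) (p : Subset m) →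
  (∀ {j} → P (f j) → j ∈ₛ p) → (∀ {j} → j ∈ₛ p → P (f j)) →
  length (filter P? (tabulate f)) ≡ ∣ p ∣
length-filter-tabulate P? f [] _ _ = refl
length-filter-tabulate P? f (inside ∷ p) sound complete with P? (f Fin.zero)
... | yes _ = cong suc (length-filter-tabulate P? (f ∘ Fin.suc) p
                          (Subset.drop-there ∘ sound) (complete ∘ Vec.there))
... | no ¬Pf₀ = contradiction (complete Vec.here) ¬Pf₀
length-filter-tabulate P? f (outside ∷ p) sound complete with P? (f Fin.zero)
... | yes Pf₀ with () ← sound Pf₀
... | no _ = length-filter-tabulate P? (f ∘ Fin.suc) p
               (Subset.drop-there ∘ sound) (complete ∘ Vec.there)

product-≤-^ : {xs : List ℕ} → All (_≤ k) xs → product xs ≤ k ^ length xs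
product-≤-^ [] = ℕ.≤-refl
product-≤-^ (x≤k ∷ xs≤k) = ℕ.*-mono-≤ x≤k (product-≤-^ xs≤k)

∈⇒product-≤ : ∀ {x} {xs : List ℕ} → x ∈ xs → All (_≤ k) xs →
  product xs ≤ x * k ^ (length xs ∸ 1)
∈⇒product-≤ {k} {x} x∈xs xs≤k with ws , zs , refl ← ∈-∃++ x∈xs = begin
  product (ws ++ x ∷ zs)              ≡⟨ product-↭ (shift x ws zs) ⟩
  x * product (ws ++ zs)              ≤⟨ ℕ.*-monoʳ-≤ x (product-≤-^ rest≤k) ⟩
  x * k ^ length (ws ++ zs)           ≡⟨ cong (λ l → x * k ^ (l ∸ 1)) (↭-length (shift x ws zs)) ⟨
  x * k ^ (length (ws ++ x ∷ zs) ∸ 1) ∎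
  where
  open ℕ.≤-Reasoning
  rest≤k : All (_≤ k) (ws ++ zs)
  rest≤k = All.tail (All-resp-↭ (shift x ws zs) xs≤k)

^-pred : ∀ k n .{{_ : NonZero n}} → k ^ n ≡ k * k ^ (n ∸ 1)
^-pred k (suc n) = refl

*-foldr-+-≤ : ∀ (p d : ℤ) (xs : List ℤ) → All (λ a → p ℤ.* a ≤ℤ d) xs →
  p ℤ.* foldr ℤ._+_ (+ 0) xs ≤ℤ + length xs ℤ.* d
*-foldr-+-≤ p d [] [] = ℤ.≤-reflexive (trans (ℤ.*-zeroʳ p) (sym (ℤ.*-zeroˡ d)))
*-foldr-+-≤ p d (a ∷ xs) (pa≤d ∷ pxs≤d) = begin
  p ℤ.* (a ℤ.+ foldr ℤ._+_ (+ 0) xs)      ≡⟨ ℤ.*-distribˡ-+ p a _ ⟩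
  p ℤ.* a ℤ.+ p ℤ.* foldr ℤ._+_ (+ 0) xs  ≤⟨ ℤ.+-mono-≤ pa≤d (*-foldr-+-≤ p d xs pxs≤d) ⟩
  d ℤ.+ + length xs ℤ.* d                 ≡⟨ cong (ℤ._+ + length xs ℤ.* d) (ℤ.*-identityˡ d) ⟨
  + 1 ℤ.* d ℤ.+ + length xs ℤ.* d         ≡⟨ ℤ.*-distribʳ-+ d (+ 1) (+ length xs) ⟨
  + suc (length xs) ℤ.* d                 ∎
  where open ℤ.≤-Reasoning

a/1-b/1≤-z/n : ∀ (a b z : ℤ) (n : ℕ) .{{_ : NonZero n}} →
  z ≤ℤ + n ℤ.* (b ℤ.- a) → (a / 1) ℚ.- (b / 1) ℚ.≤ (ℤ.- z) / n
-- ℚ's _/_ normalises, so compare through ℚᵘ, where ≤ is plain cross-multiplication.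
a/1-b/1≤-z/n a b z (suc n) z≤n[b-a] =
  ℚ.toℚᵘ-cancel-≤ (ℚᵘ.≤-respˡ-≃ (ℚᵘ.≃-sym lhs≃) (ℚᵘ.≤-respʳ-≃ (ℚᵘ.≃-sym rhs≃) (*≤* cross)))
  where
  lhs≃ : toℚᵘ ((a / 1) ℚ.- (b / 1)) ℚᵘ.≃ mkℚᵘ a 0 ℚᵘ.- mkℚᵘ b 0
  lhs≃ = ℚᵘ.≃-trans (ℚ.toℚᵘ-homo-+ (a / 1) (ℚ.- (b / 1)))
           (ℚᵘ.+-cong (ℚ.toℚᵘ-fromℚᵘ (mkℚᵘ a 0))
              (ℚᵘ.≃-trans (ℚ.toℚᵘ-homo‿- (b / 1)) (ℚᵘ.-‿cong (ℚ.toℚᵘ-fromℚᵘ (mkℚᵘ b 0)))))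
  rhs≃ : toℚᵘ ((ℤ.- z) / suc n) ℚᵘ.≃ mkℚᵘ (ℤ.- z) n
  rhs≃ = ℚ.toℚᵘ-fromℚᵘ (mkℚᵘ (ℤ.- z) n)
  cross-identity : ∀ (d a b : ℤ) → (a ℤ.* + 1 ℤ.+ ℤ.- b ℤ.* + 1) ℤ.* d ≡ ℤ.- (d ℤ.* (b ℤ.- a))
  cross-identity = solve-∀
  cross : (a ℤ.* + 1 ℤ.+ ℤ.- b ℤ.* + 1) ℤ.* + suc n ≤ℤ ℤ.- z ℤ.* + 1
  cross = begin
    (a ℤ.* + 1 ℤ.+ ℤ.- b ℤ.* + 1) ℤ.* + suc n  ≡⟨ cross-identity (+ suc n) a b ⟩
    ℤ.- (+ suc n ℤ.* (b ℤ.- a))                ≤⟨ ℤ.neg-mono-≤ z≤n[b-a] ⟩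
    ℤ.- z                                      ≡⟨ ℤ.*-identityʳ (ℤ.- z) ⟨
    ℤ.- z ℤ.* + 1                              ∎
    where open ℤ.≤-Reasoning

-- The decider used inside interCard, so that interCard L S reduces to a filter by inAll? L S.
inAll? : (L : Fin n → List ℕ) (S : Subset n) (x : ℕ) → Dec (∀ v → v ∈ₛ S → x ∈ L v)
inAll? L S x = all? (λ v → Subset._∈?_ v S →-dec x ∈? L v)

interCard-antitone : (L : Fin n → List ℕ) {S T : Subset n} → S ⊆ₛ T → interCard L T ≤ interCard L S
interCard-antitone L S⊆T =
  length-filter-mono (inAll? L _) (inAll? L _) (λ x∈T v v∈S → x∈T v (S⊆T v∈S)) (upTo (bound L))

interCard-≤ : {L : Fin n → List ℕ} → KAssignment k L → ∀ {S v} → v ∈ₛ S → interCard L S ≤ k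
interCard-≤ {L = L} KA {S} {v} v∈S = subst (interCard L S ≤_) (proj₁ (KA v))
  (unique-⊆⇒length-≤ (Unique.filter⁺ (inAll? L S) (Unique.upTo⁺ (bound L)))
                     (λ x∈ → proj₂ (∈-filter⁻ (inAll? L S) x∈) v v∈S))

edge-nonempty : (H : Hypergraph n m) (j : Fin m) → Nonempty (edge H j)
edge-nonempty {n} H j with Subset.nonempty? (edge H j)
... | yes nonempty = nonempty
... | no empty = contradiction (subst (2 ≤_) ∣edge∣≡0 (edge-size H j)) λ ()
  where
  ∣edge∣≡0 : ∣ edge H j ∣ ≡ 0
  ∣edge∣≡0 = trans (cong ∣_∣ (Subset.Empty-unique empty)) (Subset.∣⊥∣≡0 n)

≡⇒∈-classOf : (comp : Fin n → Fin c) {v : Fin n} {i : Fin c} → comp v ≡ i → v ∈ₛ classOf comp i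
≡⇒∈-classOf comp {v} {i} comp-v≡i =
  lookup⇒[]= v _ (trans (lookup∘tabulate _ v) (dec-true (comp v Fin.≟ i) comp-v≡i))

module _ {H : Hypergraph n m} {A : Subset m} {L : Fin n → List ℕ} {comp : Fin n → Fin c}
         (KA : KAssignment k L) (IC : IsComponentLabelling H A c comp) where

  open IsComponentLabelling IC

  edge⊆classOf : ∀ {j v} → j ∈ₛ A → v ∈ₛ edge H j → edge H j ⊆ₛ classOf comp (comp v)
  edge⊆classOf {j} {v} j∈A v∈e {w} w∈e = ≡⇒∈-classOf comp (complete w v (step j here j∈A w∈e v∈e))

  classCard-≤ : ∀ i → interCard L (classOf comp i) ≤ k
  classCard-≤ i with w , comp-w≡i ← surjective i = interCard-≤ KA (≡⇒∈-classOf comp comp-w≡i)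

  β-≤-edge : ∀ {j} → j ∈ₛ A → β L comp ≤ interCard L (edge H j) * k ^ (c ∸ 1)
  β-≤-edge {j} j∈A with v , v∈e ← edge-nonempty H j = begin
    product cards                          ≤⟨ ∈⇒product-≤ (∈-map⁺ card (∈-allFin (comp v))) cards≤k ⟩
    card (comp v) * k ^ (length cards ∸ 1) ≡⟨ cong (λ l → card (comp v) * k ^ (l ∸ 1)) length-cards ⟩
    card (comp v) * k ^ (c ∸ 1)            ≤⟨ ℕ.*-monoˡ-≤ (k ^ (c ∸ 1)) (interCard-antitone L (edge⊆classOf j∈A v∈e)) ⟩
    interCard L (edge H j) * k ^ (c ∸ 1)   ∎
    where
    open ℕ.≤-Reasoning
    card : Fin c → ℕ
    card i = interCard L (classOf comp i)
    cards : List ℕ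
    cards = map card (allFin c)
    cards≤k : All (_≤ k) cards
    cards≤k = All.map⁺ (All.tabulate⁺ classCard-≤)
    length-cards : length cards ≡ c
    length-cards = trans (length-map card (allFin c)) (length-tabulate _)

  α-bound : ∀ {j} → j ∈ₛ A → + k ^ (c ∸ 1) ℤ.* α H k L j ≤ℤ + k ^ c ℤ.- + β L comp
  α-bound {j} j∈A with v , _ ← edge-nonempty H j = begin
    + P ℤ.* (+ k ℤ.- + I)        ≡⟨ distrib (+ P) (+ k) (+ I) ⟩
    + k ℤ.* + P ℤ.- + I ℤ.* + P  ≡⟨ cong₂ ℤ._-_ (ℤ.pos-* k P) (ℤ.pos-* I P) ⟨
    + (k * P) ℤ.- + (I * P)      ≤⟨ ℤ.+-monoʳ-≤ (+ (k * P)) (ℤ.neg-mono-≤ (+≤+ (β-≤-edge j∈A))) ⟩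
    + (k * P) ℤ.- + β L comp     ≡⟨ cong (λ x → + x ℤ.- + β L comp) (^-pred k c {{nonZeroIndex (comp v)}}) ⟨
    + k ^ c ℤ.- + β L comp       ∎
    where
    open ℤ.≤-Reasoning
    P = k ^ (c ∸ 1)
    I = interCard L (edge H j)
    distrib : ∀ (p a b : ℤ) → p ℤ.* (a ℤ.- b) ≡ a ℤ.* p ℤ.- b ℤ.* p
    distrib = solve-∀

  sumα-bound : + k ^ (c ∸ 1) ℤ.* sumα H k L A ≤ℤ + ∣ A ∣ ℤ.* (+ k ^ c ℤ.- + β L comp)
  sumα-bound = subst (λ l → + k ^ (c ∸ 1) ℤ.* sumα H k L A ≤ℤ + l ℤ.* d) length-αs
                     (*-foldr-+-≤ (+ k ^ (c ∸ 1)) d αs αs-bounded)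
    where
    d = + k ^ c ℤ.- + β L comp
    edgesOfA = filter (Subset._∈? A) (allFin m)
    αs = map (α H k L) edgesOfA
    αs-bounded : All (λ a → + k ^ (c ∸ 1) ℤ.* a ≤ℤ d) αs
    αs-bounded = All.map⁺ (All.map α-bound (All.all-filter (Subset._∈? A) (allFin m)))
    length-αs : length αs ≡ ∣ A ∣
    length-αs = trans (length-map _ edgesOfA)
                      (length-filter-tabulate (Subset._∈? A) (λ j → j) A (λ j∈A → j∈A) (λ j∈A → j∈A))

proposition2p4 : ∀ {n m : ℕ} (H : Hypergraph n m) (k : ℕ) → 1 ≤ k →
    (L : Fin n → List ℕ) → KAssignment k L →
    (A : Subset m) → (ne : Nonempty A) →
    (c : ℕ) (comp : Fin n → Fin c) → IsComponentLabelling H A c comp →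
    ((+ β L comp) / 1) ℚ.- ((+ (k ^ c)) / 1)
      ℚ.≤ divByCard (ℤ.- ((+ (k ^ (c ∸ 1))) ℤ.* sumα H k L A)) A ne
proposition2p4 H k _ L KA A ne c comp IC =
  a/1-b/1≤-z/n (+ β L comp) (+ k ^ c) (+ k ^ (c ∸ 1) ℤ.* sumα H k L A) ∣ A ∣
               {{ℕ.>-nonZero (∣A∣>0 A ne)}} (sumα-bound KA IC)
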